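{- For every integer $n \equiv 3 \pmod 6$ with $n \geq 9$, there exists an edge-maximal doubly Eulerian graph of order $n$; that is, there exists a doubly Eulerian graph of order $n$ in which every vertex has degree $n-3$.
   Context: All graphs are finite, simple (no loops or multiple edges) and connected. A graph is Eulerian if it has a closed trail traversing every edge exactly once (an Eulerian circuit). Let $G$ be Eulerian with $m$ edges and $u$ a vertex. Two Eulerian circuits $u,v_1,\ldots,v_{m-1},u$ and $u,w_1,\ldots,w_{m-1},u$ starting and ending at $u$ are avoiding if for every $1\le i\le m-1$, $v_i\neq w_i$ and $v_i$ is not adjacent to $w_i$. $G$ is doubly Eulerian if for every vertex $u$ there is a pair of avoiding Eulerian circuits starting and ending at $u$. A doubly Eulerian graph of odd order $n$ is called edge-maximal if it attains the largest possible number of edges, namely if it is regular of degree $n-3$ (no doubly Eulerian graph of odd order $n$ has a vertex of degree $n-1$, and degrees are even). -}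

module Defs where

open import Data.Nat using (ℕ; zero; suc)
open import Data.Fin using (Fin; zero; suc; inject₁; fromℕ)
open import Data.Bool using (Bool; true; false; T)
open import Data.List using (List; length; filter; allFin)
open import Data.Product using (Σ; ∃; _×_; _,_)
open import Data.Sum using (_⊎_)
open import Relation.Binary.PropositionalEquality using (_≡_)
open import Relation.Nullary using (¬_)
open import Data.Bool.Properties using (T?)

record Graph (n : ℕ) : Set where
  field
    adj   : Fin n → Fin n → Bool
    sym   : ∀ x y → adj x y ≡ adj y x
    irrefl : ∀ x → adj x x ≡ false

open Graph public

Adj : ∀ {n} → Graph n → Fin n → Fin n → Set
Adj G x y = T (adj G x y)

IsWalk : ∀ {n} → Graph n → (k : ℕ) → (Fin (suc k) → Fin n) → Set
IsWalk G k w = ∀ (i : Fin k) → Adj G (w (inject₁ i)) (w (suc i))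

Connected : ∀ {n} → Graph n → Set
Connected {n} G = ∀ (x y : Fin n) →
  Σ ℕ λ k → Σ (Fin (suc k) → Fin n) λ w →
    IsWalk G k w × w zero ≡ x × w (fromℕ k) ≡ y

degree : ∀ {n} → Graph n → Fin n → ℕ
degree {n} G x = length (filter (λ y → T? (adj G x y)) (allFin n))

Traverses : ∀ {n k} → (Fin (suc k) → Fin n) → Fin k → Fin n → Fin n → Set
Traverses w i x y =
  (w (inject₁ i) ≡ x × w (suc i) ≡ y) ⊎ (w (inject₁ i) ≡ y × w (suc i) ≡ x)

IsEulerianCircuit : ∀ {n} → Graph n → Fin n → (m : ℕ) → (Fin (suc m) → Fin n) → Set
IsEulerianCircuit {n} G u m w =
  IsWalk G m w × w zero ≡ u × w (fromℕ m) ≡ u ×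
  (∀ (x y : Fin n) → Adj G x y →
     Σ (Fin m) λ i → Traverses w i x y × (∀ (j : Fin m) → Traverses w j x y → j ≡ i))

Eulerian : ∀ {n} → Graph n → Set
Eulerian {n} G = Connected G ×
  Σ (Fin n) λ u → Σ ℕ λ m → Σ (Fin (suc m) → Fin n) λ w → IsEulerianCircuit G u m w

-- Interior positions are suc (inject₁ j) for j : Fin (m-1); we index with m = suc m'.
Avoiding : ∀ {n} → Graph n → (m : ℕ) → (Fin (suc m) → Fin n) → (Fin (suc m) → Fin n) → Set
Avoiding G zero v w = Data.Unit.⊤
  where import Data.Unit
Avoiding G (suc m') v w =
  ∀ (j : Fin m') → ¬ (v (suc (inject₁ j)) ≡ w (suc (inject₁ j)))
                 × ¬ Adj G (v (suc (inject₁ j))) (w (suc (inject₁ j)))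

DoublyEulerian : ∀ {n} → Graph n → Set
DoublyEulerian {n} G = Eulerian G ×
  (∀ (u : Fin n) → Σ ℕ λ m → Σ (Fin (suc m) → Fin n) λ v → Σ (Fin (suc m) → Fin n) λ w →
     IsEulerianCircuit G u m v × IsEulerianCircuit G u m w × Avoiding G m v w)

-- The graph is the complete t-partite graph with three vertices per part (t = n/3, odd),
-- which is (n − 3)-regular.  An Eulerian circuit of K_t is lifted to it by running along
-- the circuit nine times, visiting at step l of round c the vertex of part pos l on level
-- levelAt l c; when each step pairs the nine rounds bijectively with the nine level pairs
-- {0,1,2}², every edge of the blow-up is traversed exactly once.  Two level schedules
-- that differ everywhere except at the start give avoiding circuits: the two walkers are
-- always in the same part, hence non-adjacent, but on different levels.  Shifting all
-- levels mod 3 moves the start to any vertex.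
module Submission where

open import Defs hiding (sym)
open import Data.Nat using (ℕ; _≤_; _∸_; _%_)
open import Data.Product using (Σ; _×_)
open import Data.Fin using (Fin)
open import Relation.Binary.PropositionalEquality using (_≡_)

open import Data.Nat
open import Data.Nat.Properties
open import Data.Nat.DivMod
open import Data.Nat.Tactic.RingSolver using (solve-∀)
open import Data.Bool using (Bool; true; false; not; T; if_then_else_)
open import Data.Bool.Properties using (T?)
open import Data.List using (length; filter; tabulate)
open import Data.Fin as Fin using (toℕ; fromℕ<; fromℕ; inject₁)
open import Data.Fin.Properties using (toℕ-injective; toℕ<n; toℕ-fromℕ; toℕ-fromℕ<; toℕ-inject₁)
open import Data.Product using (∃; _,_; proj₁; proj₂)
open import Data.Sum using (_⊎_; inj₁; inj₂; [_,_]′)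
open import Data.Empty using (⊥; ⊥-elim)
open import Data.Unit using (tt)
open import Function using (_∘_)
open import Relation.Nullary using (¬_; Dec; yes; no)
open import Relation.Nullary.Decidable using (_×-dec_; _→-dec_; ¬?; from-yes; dec-true; dec-false)
open import Relation.Binary.PropositionalEquality
open import Relation.Binary.Definitions using (tri<; tri≈; tri>)

module Modulo (d : ℕ) .{{_ : NonZero d}} where

  [m+kn]%n≡m : ∀ r q → r < d → (r + q * d) % d ≡ r
  [m+kn]%n≡m r q r<d = trans ([m+kn]%n≡m%n r q d) (m<n⇒m%n≡m r<d)

  [m+kn]/n≡k : ∀ r q → r < d → (r + q * d) / d ≡ q
  [m+kn]/n≡k r q r<d = begin
    (r + q * d) / d    ≡⟨ +-distrib-/ r (q * d) remainders<d ⟩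
    r / d + q * d / d  ≡⟨ cong₂ _+_ (m<n⇒m/n≡0 r<d) (m*n/n≡m q d) ⟩
    q                  ∎
    where
    open ≡-Reasoning
    remainders<d : r % d + q * d % d < d
    remainders<d = subst (_< d) (sym (trans (cong₂ _+_ (m<n⇒m%n≡m r<d) (m*n%n≡0 q d)) (+-identityʳ r))) r<d

  %-+-congʳ : ∀ a b c → a % d ≡ b % d → (a + c) % d ≡ (b + c) % d
  %-+-congʳ a b c e = begin
    (a + c) % d           ≡⟨ %-distribˡ-+ a c d ⟩
    (a % d + c % d) % d   ≡⟨ cong (λ z → (z + c % d) % d) e ⟩
    (b % d + c % d) % d   ≡⟨ %-distribˡ-+ b c d ⟨
    (b + c) % d           ∎
    where open ≡-Reasoning

  %-*-congˡ : ∀ a b c → a % d ≡ b % d → (c * a) % d ≡ (c * b) % d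
  %-*-congˡ a b c e = begin
    (c * a) % d               ≡⟨ %-distribˡ-* c a d ⟩
    (c % d * (a % d)) % d     ≡⟨ cong (λ z → (c % d * z) % d) e ⟩
    (c % d * (b % d)) % d     ≡⟨ %-distribˡ-* c b d ⟨
    (c * b) % d               ∎
    where open ≡-Reasoning

  [m%n+o]%n≡[m+o]%n : ∀ a c → (a % d + c) % d ≡ (a + c) % d
  [m%n+o]%n≡[m+o]%n a c = %-+-congʳ (a % d) a c (m%n%n≡m%n a d)

  -- adding (d ∸ 1) * c undoes adding c, since c + (d ∸ 1) * c is a multiple of d
  %-+-cancelʳ : ∀ a b c → (a + c) % d ≡ (b + c) % d → a % d ≡ b % d
  %-+-cancelʳ a b c e = begin
    a % d                    ≡⟨ [m+kn]%n≡m%n a c d ⟨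
    (a + c * d) % d          ≡⟨ cong (_% d) (regroup a) ⟩
    (a + c + (d ∸ 1) * c) % d ≡⟨ %-+-congʳ (a + c) (b + c) ((d ∸ 1) * c) e ⟩
    (b + c + (d ∸ 1) * c) % d ≡⟨ cong (_% d) (regroup b) ⟨
    (b + c * d) % d          ≡⟨ [m+kn]%n≡m%n b c d ⟩
    b % d                    ∎
    where
    open ≡-Reasoning
    regroup : ∀ x → x + c * d ≡ x + c + (d ∸ 1) * c
    regroup x = trans (cong (λ z → x + c * z) (sym (suc-pred d))) (lemma x c (d ∸ 1))
      where
      lemma : ∀ x c e → x + c * suc e ≡ x + c + e * c
      lemma = solve-∀

  <⇒%-injective : ∀ {a b} → a < d → b < d → a % d ≡ b % d → a ≡ b
  <⇒%-injective a<d b<d e = trans (sym (m<n⇒m%n≡m a<d)) (trans e (m<n⇒m%n≡m b<d))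

  [m+o]%n≢m%n : ∀ a {e} → 0 < e → e < d → (a + e) % d ≢ a % d
  [m+o]%n≢m%n a {e} 0<e e<d h = <⇒≢ 0<e (sym e≡0)
    where
    e≡0 : e ≡ 0
    e≡0 = <⇒%-injective e<d (≤-trans (s≤s z≤n) e<d)
            (%-+-cancelʳ e 0 a (trans (cong (_% d) (+-comm e a)) h))

  data SucDivMod (l : ℕ) : Set where
    sameBlock : suc l % d ≡ suc (l % d) → suc l / d ≡ l / d → SucDivMod l
    nextBlock : suc (l % d) ≡ d → suc l % d ≡ 0 → suc l / d ≡ suc (l / d) → SucDivMod l

  sucDivMod : ∀ l → SucDivMod l
  sucDivMod l with suc (l % d) <? d
  ... | yes lt = sameBlock
        (trans (cong (_% d) split) ([m+kn]%n≡m (suc (l % d)) (l / d) lt))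
        (trans (cong (_/ d) split) ([m+kn]/n≡k (suc (l % d)) (l / d) lt))
    where
    split : suc l ≡ suc (l % d) + l / d * d
    split = cong suc (m≡m%n+[m/n]*n l d)
  ... | no ¬lt = nextBlock full
        (trans (cong (_% d) split) ([m+kn]%n≡m 0 (suc (l / d)) (>-nonZero⁻¹ d)))
        (trans (cong (_/ d) split) ([m+kn]/n≡k 0 (suc (l / d)) (>-nonZero⁻¹ d)))
    where
    full : suc (l % d) ≡ d
    full = ≤-antisym (m%n<n l d) (≮⇒≥ ¬lt)
    split : suc l ≡ 0 + suc (l / d) * d
    split = trans (cong suc (m≡m%n+[m/n]*n l d)) (cong (_+ l / d * d) full)

m≢0⇒m%n≢0⊎m/n≢0 : ∀ {m} n .{{_ : NonZero n}} → m ≢ 0 → m % n ≢ 0 ⊎ m / n ≢ 0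
m≢0⇒m%n≢0⊎m/n≢0 {m} n m≢0 with m % n ≟ 0 | m / n ≟ 0
... | no r≢0 | _ = inj₁ r≢0
... | yes _ | no q≢0 = inj₂ q≢0
... | yes r≡0 | yes q≡0 =
  ⊥-elim (m≢0 (trans (m≡m%n+[m/n]*n m n) (cong₂ (λ r q → r + q * n) r≡0 q≡0)))

triangle : ℕ → ℕ
triangle zero = 0
triangle (suc j) = triangle j + suc j

8*triangle+1≡odd² : ∀ j → 8 * triangle j + 1 ≡ suc (j + j) * suc (j + j)
8*triangle+1≡odd² zero = refl
8*triangle+1≡odd² (suc j) = begin
  8 * (triangle j + suc j) + 1                ≡⟨ step₁ (triangle j) j ⟩
  (8 * triangle j + 1) + 8 * suc j            ≡⟨ cong (_+ 8 * suc j) (8*triangle+1≡odd² j) ⟩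
  suc (j + j) * suc (j + j) + 8 * suc j       ≡⟨ step₂ j ⟩
  suc (suc j + suc j) * suc (suc j + suc j)   ∎
  where
  open ≡-Reasoning
  step₁ : ∀ a j → 8 * (a + suc j) + 1 ≡ (8 * a + 1) + 8 * suc j
  step₁ = solve-∀
  step₂ : ∀ j → suc (j + j) * suc (j + j) + 8 * suc j ≡ suc (suc j + suc j) * suc (suc j + suc j)
  step₂ = solve-∀


-- Eulerian circuits of complete graphs of odd order

record CompleteEulerCircuit (t L : ℕ) : Set where
  field
    pos              : ℕ → ℕ
    pos<t            : ∀ l → pos l < t
    pos-closed       : pos L ≡ pos 0
    step-≢           : ∀ {l} → l < L → pos l ≢ pos (suc l)
    step-injective   : ∀ {l l'} → l < L → l' < L →
                       pos l ≡ pos l' → pos (suc l) ≡ pos (suc l') → l ≡ l'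
    no-reversed-step : ∀ {l l'} → l < L → l' < L →
                       pos l ≡ pos (suc l') → pos (suc l) ≡ pos l' → ⊥
    edge-traversed   : ∀ {p q} → p < t → q < t → p ≢ q →
                       ∃ λ l → l < L × (pos l ≡ p × pos (suc l) ≡ q ⊎ pos l ≡ q × pos (suc l) ≡ p)

-- The circuit makes t rounds of k steps, the steps of each round having lengths
-- 1, 2, …, k, so that every round advances by σ = triangle k.  As 8σ + 1 = t², σ is
-- a unit modulo t, hence the t rounds start at pairwise distinct points and every
-- pair (start point, step length) occurs exactly once.
module OddCompleteEulerCircuit (k' p₀ : ℕ) where
  k t σ L : ℕ
  k = suc k'
  t = suc (k + k)
  σ = triangle k
  L = t * k

  open Modulo t

  offset : ℕ → ℕ
  offset l = l / k * σ + triangle (l % k) + p₀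

  pos : ℕ → ℕ
  pos l = offset l % t

  offset-suc : ∀ l → offset (suc l) ≡ offset l + suc (l % k)
  offset-suc l with Modulo.sucDivMod k l
  ... | sameBlock r q rewrite r | q = regroup (l / k * σ) (triangle (l % k)) (l % k) p₀
    where
    regroup : ∀ a b c p → a + (b + suc c) + p ≡ a + b + p + suc c
    regroup = solve-∀
  ... | nextBlock full r q rewrite r | q = begin
      suc (l / k) * σ + 0 + p₀                          ≡⟨ regroup₁ (l / k) σ p₀ ⟩
      l / k * σ + p₀ + triangle k                       ≡⟨ cong (λ z → l / k * σ + p₀ + triangle z) full ⟨
      l / k * σ + p₀ + (triangle (l % k) + suc (l % k)) ≡⟨ regroup₂ (l / k * σ) p₀ (triangle (l % k)) (suc (l % k)) ⟩
      offset l + suc (l % k)                            ∎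
    where
    open ≡-Reasoning
    regroup₁ : ∀ a s p → suc a * s + 0 + p ≡ a * s + p + s
    regroup₁ = solve-∀
    regroup₂ : ∀ a p b c → a + p + (b + c) ≡ a + b + p + c
    regroup₂ = solve-∀

  pos-suc : ∀ l → pos (suc l) ≡ (offset l + suc (l % k)) % t
  pos-suc l = cong (_% t) (offset-suc l)

  pos-closed : pos L ≡ pos 0
  pos-closed = begin
    (L / k * σ + triangle (L % k) + p₀) % t ≡⟨ cong₂ (λ a b → (a * σ + triangle b + p₀) % t)
                                                      (m*n/n≡m t k) (m*n%n≡0 t k) ⟩
    (t * σ + 0 + p₀) % t                    ≡⟨ cong (_% t) (regroup t σ p₀) ⟩
    (p₀ + σ * t) % t                        ≡⟨ [m+kn]%n≡m%n p₀ σ t ⟩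
    p₀ % t                                  ∎
    where
    open ≡-Reasoning
    regroup : ∀ t s p → t * s + 0 + p ≡ p + s * t
    regroup = solve-∀

  step<t : ∀ l → suc (l % k) < t
  step<t l = s≤s (≤-trans (m%n<n l k) (m≤m+n k k))

  step-≢ : ∀ l → pos l ≢ pos (suc l)
  step-≢ l e = [m+o]%n≢m%n (offset l) (s≤s z≤n) (step<t l) (trans (sym (pos-suc l)) (sym e))

  -- two steps in opposite directions would have lengths summing to a multiple of t
  no-reversed-step : ∀ l l' → pos l ≡ pos (suc l') → pos (suc l) ≡ pos l' → ⊥
  no-reversed-step l l' e₁ e₂ = [m+o]%n≢m%n (offset l') (s≤s z≤n) d'+d<t back
    where
    d d' : ℕ
    d = suc (l % k)
    d' = suc (l' % k)
    d'+d<t : d' + d < t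
    d'+d<t = s≤s (+-mono-≤ (m%n<n l' k) (m%n<n l k))
    back : (offset l' + (d' + d)) % t ≡ offset l' % t
    back = begin
      (offset l' + (d' + d)) % t ≡⟨ cong (_% t) (+-assoc (offset l') d' d) ⟨
      (offset l' + d' + d) % t   ≡⟨ %-+-congʳ (offset l' + d') (offset l) d (trans (sym (pos-suc l')) (sym e₁)) ⟩
      (offset l + d) % t         ≡⟨ trans (sym (pos-suc l)) e₂ ⟩
      offset l' % t              ∎
      where open ≡-Reasoning

  σ-inverse : ∀ r s → (8 * (r * σ) + (r + s)) % t ≡ s % t
  σ-inverse r s = begin
    (8 * (r * σ) + (r + s)) % t ≡⟨ cong (_% t) (regroup r s σ) ⟩
    (s + r * (8 * σ + 1)) % t   ≡⟨ cong (λ z → (s + r * z) % t) (8*triangle+1≡odd² k) ⟩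
    (s + r * (t * t)) % t       ≡⟨ cong (λ z → (s + z) % t) (*-assoc r t t) ⟨
    (s + r * t * t) % t         ≡⟨ [m+kn]%n≡m%n s (r * t) t ⟩
    s % t                       ∎
    where
    open ≡-Reasoning
    regroup : ∀ r s σ → 8 * (r * σ) + (r + s) ≡ s + r * (8 * σ + 1)
    regroup = solve-∀

  *σ-injective : ∀ {r r'} → r < t → r' < t → (r * σ) % t ≡ (r' * σ) % t → r ≡ r'
  *σ-injective {r} {r'} r<t r'<t e = sym (<⇒%-injective r'<t r<t (begin
    r' % t                         ≡⟨ σ-inverse r r' ⟨
    (8 * (r * σ) + (r + r')) % t   ≡⟨ %-+-congʳ (8 * (r * σ)) (8 * (r' * σ)) (r + r')
                                        (%-*-congˡ (r * σ) (r' * σ) 8 e) ⟩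
    (8 * (r' * σ) + (r + r')) % t  ≡⟨ cong (λ z → (8 * (r' * σ) + z) % t) (+-comm r r') ⟩
    (8 * (r' * σ) + (r' + r)) % t  ≡⟨ σ-inverse r' r ⟩
    r % t                          ∎))
    where open ≡-Reasoning

  step-injective : ∀ {l l'} → l < L → l' < L → pos l ≡ pos l' → pos (suc l) ≡ pos (suc l') → l ≡ l'
  step-injective {l} {l'} l<L l'<L e₁ e₂ = begin
    l                   ≡⟨ m≡m%n+[m/n]*n l k ⟩
    l % k + l / k * k   ≡⟨ cong₂ (λ a b → a + b * k) same-length same-round ⟩
    l' % k + l' / k * k ≡⟨ m≡m%n+[m/n]*n l' k ⟨
    l'                  ∎
    where
    open ≡-Reasoning
    j j' : ℕ
    j = l % k
    j' = l' % k
    lengths : (offset l' + suc j) % t ≡ (offset l' + suc j') % t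
    lengths = trans (%-+-congʳ (offset l') (offset l) (suc j) (sym e₁))
                    (trans (sym (pos-suc l)) (trans e₂ (pos-suc l')))
    same-length : j ≡ j'
    same-length = suc-injective (<⇒%-injective (step<t l) (step<t l')
      (%-+-cancelʳ (suc j) (suc j') (offset l') (trans (cong (_% t) (+-comm (suc j) (offset l')))
                               (trans lengths (cong (_% t) (+-comm (offset l') (suc j')))))))
    starts : (l / k * σ + (triangle j' + p₀)) % t ≡ (l' / k * σ + (triangle j' + p₀)) % t
    starts = trans (cong (_% t) (trans (sym (+-assoc (l / k * σ) (triangle j') p₀))
                                       (cong (λ z → l / k * σ + triangle z + p₀) (sym same-length))))
                   (trans e₁ (cong (_% t) (+-assoc (l' / k * σ) (triangle j') p₀)))
    same-round : l / k ≡ l' / k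
    same-round = *σ-injective (m<n*o⇒m/o<n l<L) (m<n*o⇒m/o<n l'<L)
                   (%-+-cancelʳ (l / k * σ) (l' / k * σ) (triangle j' + p₀) starts)

  -- Since 8σ ≡ −1 (mod t), round r = 8e mod t with e ≡ triangle j + p₀ − x takes its
  -- step of length suc j from x.
  step-from : ∀ {x} d → x < t → 0 < d → d ≤ k → ∃ λ l → l < L × pos l ≡ x × pos (suc l) ≡ (x + d) % t
  step-from {x} (suc j) x<t _ j<k = l , l<L , pos-l , pos-suc-l
    where
    c e r l : ℕ
    c = triangle j + p₀
    e = c + (t ∸ x)
    r = (8 * e) % t
    l = j + r * k
    l%k≡j : l % k ≡ j
    l%k≡j = Modulo.[m+kn]%n≡m k j r j<k
    l<L : l < L
    l<L = begin-strict
      j + r * k  <⟨ +-monoˡ-< (r * k) j<k ⟩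
      suc r * k  ≤⟨ *-monoˡ-≤ k (m%n<n (8 * e) t) ⟩
      t * k      ∎
      where open ≤-Reasoning
    round-start : (r * σ) % t ≡ (8 * e * σ) % t
    round-start = begin
      (r * σ) % t          ≡⟨ cong (_% t) (*-comm r σ) ⟩
      (σ * r) % t          ≡⟨ %-*-congˡ r (8 * e) σ (m%n%n≡m%n (8 * e) t) ⟩
      (σ * (8 * e)) % t    ≡⟨ cong (_% t) (*-comm σ (8 * e)) ⟩
      (8 * e * σ) % t      ∎
      where open ≡-Reasoning
    pos-l : pos l ≡ x
    pos-l = begin
      (l / k * σ + triangle (l % k) + p₀) % t ≡⟨ cong₂ (λ a b → (a * σ + triangle b + p₀) % t)
                                                        (Modulo.[m+kn]/n≡k k j r j<k) l%k≡j ⟩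
      (r * σ + triangle j + p₀) % t           ≡⟨ cong (_% t) (+-assoc (r * σ) (triangle j) p₀) ⟩
      (r * σ + c) % t                         ≡⟨ %-+-congʳ (r * σ) (8 * e * σ) c round-start ⟩
      (8 * e * σ + c) % t                     ≡⟨ [m+n]%n≡m%n (8 * e * σ + c) t ⟨
      (8 * e * σ + c + t) % t                 ≡⟨ cong (_% t) (regroup (8 * e * σ) c) ⟩
      (8 * e * σ + (c + (t ∸ x) + x)) % t     ≡⟨ cong (λ z → (z + (e + x)) % t) (*-assoc 8 e σ) ⟩
      (8 * (e * σ) + (e + x)) % t             ≡⟨ σ-inverse e x ⟩
      x % t                                   ≡⟨ m<n⇒m%n≡m x<t ⟩
      x                                       ∎
      where
      open ≡-Reasoning
      regroup : ∀ a c → a + c + t ≡ a + (c + (t ∸ x) + x)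
      regroup a c = trans (cong (a + c +_) (sym (m∸n+n≡m (<⇒≤ x<t)))) (reassociate a c (t ∸ x) x)
        where
        reassociate : ∀ a c u x → a + c + (u + x) ≡ a + (c + u + x)
        reassociate = solve-∀
    pos-suc-l : pos (suc l) ≡ (x + suc j) % t
    pos-suc-l = trans (pos-suc l) (trans (cong (λ z → (offset l + suc z) % t) l%k≡j)
                  (%-+-congʳ (offset l) x (suc j) (trans pos-l (sym (m<n⇒m%n≡m x<t)))))

  pos-from : ∀ {p q} → p < q → q < t →
             ∃ λ l → l < L × (pos l ≡ p × pos (suc l) ≡ q ⊎ pos l ≡ q × pos (suc l) ≡ p)
  pos-from {p} {q} p<q q<t with q ∸ p ≤? k
  ... | yes d≤k =
    let (l , l<L , e₁ , e₂) = step-from (q ∸ p) (<-trans p<q q<t) (m<n⇒0<n∸m p<q) d≤k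
    in l , l<L , inj₁ (e₁ , trans e₂ forward)
    where
    forward : (p + (q ∸ p)) % t ≡ q
    forward = trans (cong (_% t) (m+[n∸m]≡n (<⇒≤ p<q))) (m<n⇒m%n≡m q<t)
  ... | no d≰k =
    let (l , l<L , e₁ , e₂) = step-from (t ∸ d) q<t (m<n⇒0<n∸m d<t) t∸d≤k
    in l , l<L , inj₂ (e₁ , trans e₂ backward)
    where
    d : ℕ
    d = q ∸ p
    d<t : d < t
    d<t = ≤-<-trans (m∸n≤m q p) q<t
    t∸d≤k : t ∸ d ≤ k
    t∸d≤k = ≤-trans (∸-monoʳ-≤ t (≰⇒> d≰k)) (≤-reflexive (m+n∸n≡m k k))
    backward : (q + (t ∸ d)) % t ≡ p
    backward = begin
      (q + (t ∸ d)) % t      ≡⟨ cong (λ z → (z + (t ∸ d)) % t) (m+[n∸m]≡n (<⇒≤ p<q)) ⟨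
      (p + d + (t ∸ d)) % t  ≡⟨ cong (_% t) (+-assoc p d (t ∸ d)) ⟩
      (p + (d + (t ∸ d))) % t ≡⟨ cong (λ z → (p + z) % t) (m+[n∸m]≡n (<⇒≤ d<t)) ⟩
      (p + t) % t            ≡⟨ [m+n]%n≡m%n p t ⟩
      p % t                  ≡⟨ m<n⇒m%n≡m (<-trans p<q q<t) ⟩
      p                      ∎
      where open ≡-Reasoning

  circuit : CompleteEulerCircuit t L
  circuit = record
    { pos              = pos
    ; pos<t            = λ l → m%n<n (offset l) t
    ; pos-closed       = pos-closed
    ; step-≢           = λ {l} _ → step-≢ l
    ; step-injective   = step-injective
    ; no-reversed-step = λ {l} {l'} _ _ → no-reversed-step l l'
    ; edge-traversed   = edge-traversed
    }
    where
    swap : ∀ {p q} → ∃ (λ l → l < L × (pos l ≡ p × pos (suc l) ≡ q ⊎ pos l ≡ q × pos (suc l) ≡ p))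
                   → ∃ (λ l → l < L × (pos l ≡ q × pos (suc l) ≡ p ⊎ pos l ≡ p × pos (suc l) ≡ q))
    swap (l , l<L , e) = l , l<L , [ inj₂ , inj₁ ]′ e
    edge-traversed : ∀ {p q} → p < t → q < t → p ≢ q →
                     ∃ λ l → l < L × (pos l ≡ p × pos (suc l) ≡ q ⊎ pos l ≡ q × pos (suc l) ≡ p)
    edge-traversed {p} {q} p<t q<t p≢q with <-cmp p q
    ... | tri< p<q _ _ = pos-from p<q q<t
    ... | tri≈ _ p≡q _ = ⊥-elim (p≢q p≡q)
    ... | tri> _ _ q<p = swap (pos-from q<p p<t)

-- Level schedules

PairBijective : (ℕ → ℕ) → (ℕ → ℕ) → Set
PairBijective X Y =
  (∀ {c} → c < 9 → ∀ {c'} → c' < 9 → X c ≡ X c' × Y c ≡ Y c' → c ≡ c') ×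
  (∀ {α} → α < 3 → ∀ {β} → β < 3 → ∃ λ c → c < 9 × (X c ≡ α × Y c ≡ β))

pairBijective? : ∀ X Y → Dec (PairBijective X Y)
pairBijective? X Y =
  allUpTo? (λ c → allUpTo? (λ c' → (X c ≟ X c' ×-dec Y c ≟ Y c') →-dec c ≟ c') 9) 9
  ×-dec allUpTo? (λ α → allUpTo? (λ β → anyUpTo? (λ c → X c ≟ α ×-dec Y c ≟ β) 9) 3) 3

PairBijective-≗ : ∀ {X X' Y Y'} → X ≗ X' → Y ≗ Y' → PairBijective X' Y' → PairBijective X Y
PairBijective-≗ {X} {X'} {Y} {Y'} X≗X' Y≗Y' (injective , surjective) = injective' , surjective'
  where
  injective' : ∀ {c} → c < 9 → ∀ {c'} → c' < 9 → X c ≡ X c' × Y c ≡ Y c' → c ≡ c'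
  injective' {c} c<9 {c'} c'<9 (eX , eY) =
    injective c<9 c'<9 (trans (sym (X≗X' c)) (trans eX (X≗X' c')) , trans (sym (Y≗Y' c)) (trans eY (Y≗Y' c')))
  surjective' : ∀ {α} → α < 3 → ∀ {β} → β < 3 → ∃ λ c → c < 9 × (X c ≡ α × Y c ≡ β)
  surjective' α<3 β<3 =
    let (c , c<9 , eX , eY) = surjective α<3 β<3 in c , c<9 , trans (X≗X' c) eX , trans (Y≗Y' c) eY

shift : ℕ → (ℕ → ℕ) → ℕ → ℕ
shift a X c = (X c + a) % 3

shift-injective : ∀ a {x y} → x < 3 → y < 3 → (x + a) % 3 ≡ (y + a) % 3 → x ≡ y
shift-injective a {x} {y} x<3 y<3 e = Modulo.<⇒%-injective 3 x<3 y<3 (Modulo.%-+-cancelʳ 3 x y a e)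

unshift : ∀ a {α} → α < 3 → ((α + 2 * a) % 3 + a) % 3 ≡ α
unshift a {α} α<3 = begin
  ((α + 2 * a) % 3 + a) % 3 ≡⟨ Modulo.[m%n+o]%n≡[m+o]%n 3 (α + 2 * a) a ⟩
  (α + 2 * a + a) % 3       ≡⟨ cong (_% 3) (regroup α a) ⟩
  (α + a * 3) % 3           ≡⟨ Modulo.[m+kn]%n≡m 3 α a α<3 ⟩
  α                         ∎
  where
  open ≡-Reasoning
  regroup : ∀ α a → α + 2 * a + a ≡ α + a * 3
  regroup = solve-∀

PairBijective-shift : ∀ a {X Y} → (∀ c → X c < 3) → (∀ c → Y c < 3) →
                      PairBijective X Y → PairBijective (shift a X) (shift a Y)
PairBijective-shift a {X} {Y} X<3 Y<3 (injective , surjective) = injective' , surjective'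
  where
  injective' : ∀ {c} → c < 9 → ∀ {c'} → c' < 9 →
               shift a X c ≡ shift a X c' × shift a Y c ≡ shift a Y c' → c ≡ c'
  injective' {c} c<9 {c'} c'<9 (eX , eY) =
    injective c<9 c'<9 (shift-injective a (X<3 c) (X<3 c') eX , shift-injective a (Y<3 c) (Y<3 c') eY)
  surjective' : ∀ {α} → α < 3 → ∀ {β} → β < 3 →
                ∃ λ c → c < 9 × (shift a X c ≡ α × shift a Y c ≡ β)
  surjective' {α} α<3 {β} β<3 =
    let (c , c<9 , eX , eY) = surjective (m%n<n (α + 2 * a) 3) (m%n<n (β + 2 * a) 3)
    in c , c<9 , trans (cong (λ z → (z + a) % 3) eX) (unshift a α<3)
               , trans (cong (λ z → (z + a) % 3) eY) (unshift a β<3)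

record LevelSchedule (L : ℕ) : Set where
  field
    levelAt        : ℕ → ℕ → ℕ
    levelAt<3      : ∀ l c → levelAt l c < 3
    levelAt-wrap   : ∀ c → levelAt L c ≡ levelAt 0 (suc c)
    levelAt-closed : levelAt 0 9 ≡ levelAt 0 0
    step-bijective : ∀ {l} → l < L → PairBijective (levelAt l) (levelAt (suc l))

shiftSchedule : ∀ {L} → ℕ → LevelSchedule L → LevelSchedule L
shiftSchedule a S = record
  { levelAt        = λ l → shift a (levelAt l)
  ; levelAt<3      = λ l c → m%n<n (levelAt l c + a) 3
  ; levelAt-wrap   = λ c → cong (λ z → (z + a) % 3) (levelAt-wrap c)
  ; levelAt-closed = cong (λ z → (z + a) % 3) levelAt-closed
  ; step-bijective = λ {l} l<L → PairBijective-shift a (levelAt<3 l) (levelAt<3 (suc l)) (step-bijective l<L)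
  }
  where open LevelSchedule S

-- Writing a round as c = 3g + f with f, g < 3, these patterns read f, g and f + g (mod 3).
byRound byBlock diagonal : ℕ → ℕ
byRound c = c % 3
byBlock c = c / 3 % 3
diagonal c = (c + c / 3) % 3

alternating : Bool → ℕ → ℕ
alternating true = byRound
alternating false = diagonal

alternating<3 : ∀ b c → alternating b c < 3
alternating<3 true c = m%n<n c 3
alternating<3 false c = m%n<n (c + c / 3) 3

alternating-step : ∀ b → PairBijective (alternating b) (alternating (not b))
alternating-step true = from-yes (pairBijective? byRound diagonal)
alternating-step false = from-yes (pairBijective? diagonal byRound)

alternating-then-byBlock : ∀ b → PairBijective (alternating b) byBlock
alternating-then-byBlock true = from-yes (pairBijective? byRound byBlock)
alternating-then-byBlock false = from-yes (pairBijective? diagonal byBlock)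

byBlock-then-byRound : PairBijective byBlock (byRound ∘ suc)
byBlock-then-byRound = from-yes (pairBijective? byBlock (byRound ∘ suc))

-- Found by computer search: it vanishes in round 0, where both circuits sit at their common
-- start, differs from byRound in every other round, and fits bijectively between
-- the neighbouring patterns below.
firstLevelTable : ℕ → ℕ
firstLevelTable 2 = 1
firstLevelTable 3 = 2
firstLevelTable 5 = 1
firstLevelTable 6 = 2
firstLevelTable 7 = 2
firstLevelTable 8 = 1
firstLevelTable _ = 0

firstLevelW : ℕ → ℕ
firstLevelW c = firstLevelTable (c % 9)

firstLevelW<3 : ∀ c → firstLevelW c < 3
firstLevelW<3 c = table<3 (m%n<n c 9)
  where
  table<3 : ∀ {c} → c < 9 → firstLevelTable c < 3
  table<3 = from-yes (allUpTo? (λ c → firstLevelTable c <? 3) 9)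

firstLevelW≢byRound : ∀ {c} → c < 9 → c ≢ 0 → firstLevelW c ≢ byRound c
firstLevelW≢byRound = from-yes (allUpTo? (λ c → ¬? (c ≟ 0) →-dec ¬? (firstLevelW c ≟ byRound c)) 9)

firstLevelW-then-diagonal : PairBijective firstLevelW (shift 1 diagonal)
firstLevelW-then-diagonal = from-yes (pairBijective? firstLevelW (shift 1 diagonal))

byBlock-then-firstLevelW : PairBijective (shift 1 byBlock) (firstLevelW ∘ suc)
byBlock-then-firstLevelW = from-yes (pairBijective? (shift 1 byBlock) (firstLevelW ∘ suc))

isEven : ℕ → Bool
isEven zero = true
isEven (suc l) = not (isEven l)

module Schedules (L : ℕ) (3≤L : 3 ≤ L) where

  0≢L : 0 ≢ L
  0≢L = <⇒≢ (≤-trans (s≤s z≤n) 3≤L)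

  1≢L : 1 ≢ L
  1≢L = <⇒≢ (≤-trans (s≤s (s≤s z≤n)) 3≤L)

  2≢L : 2 ≢ L
  2≢L = <⇒≢ 3≤L

  levelV : ℕ → ℕ → ℕ
  levelV l with l ≟ L | suc l ≟ L
  ... | yes _ | _     = byRound ∘ suc
  ... | no _  | yes _ = byBlock
  ... | no _  | no _  = alternating (isEven l)

  levelV-wrapped : ∀ {l} → l ≡ L → levelV l ≗ byRound ∘ suc
  levelV-wrapped {l} l≡L c with l ≟ L
  ... | yes _ = refl
  ... | no l≢L = ⊥-elim (l≢L l≡L)

  levelV-last : ∀ {l} → suc l ≡ L → levelV l ≗ byBlock
  levelV-last {l} e c with l ≟ L | suc l ≟ L
  ... | yes l≡L | _      = ⊥-elim (1+n≢n (trans e (sym l≡L)))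
  ... | no _    | yes _  = refl
  ... | no _    | no ¬e  = ⊥-elim (¬e e)

  levelV-inner : ∀ {l} → l ≢ L → suc l ≢ L → levelV l ≗ alternating (isEven l)
  levelV-inner {l} l≢L 1+l≢L c with l ≟ L | suc l ≟ L
  ... | yes l≡L | _       = ⊥-elim (l≢L l≡L)
  ... | no _    | yes e   = ⊥-elim (1+l≢L e)
  ... | no _    | no _    = refl

  levelV-start : levelV 0 ≗ byRound
  levelV-start = levelV-inner 0≢L 1≢L

  levelV<3 : ∀ l c → levelV l c < 3
  levelV<3 l c with l ≟ L | suc l ≟ L
  ... | yes _ | _     = m%n<n (suc c) 3
  ... | no _  | yes _ = m%n<n (c / 3) 3
  ... | no _  | no _  = alternating<3 (isEven l) c

  levelV-step-bijective : ∀ {l} → l < L → PairBijective (levelV l) (levelV (suc l))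
  levelV-step-bijective {l} l<L = byCases (suc l ≟ L) (suc (suc l) ≟ L)
    where
    byCases : Dec (suc l ≡ L) → Dec (suc (suc l) ≡ L) → PairBijective (levelV l) (levelV (suc l))
    byCases (yes e) _       = PairBijective-≗ (levelV-last e) (levelV-wrapped e) byBlock-then-byRound
    byCases (no ¬e) (yes e) = PairBijective-≗ (levelV-inner (<⇒≢ l<L) ¬e) (levelV-last e)
                                (alternating-then-byBlock (isEven l))
    byCases (no ¬e) (no ¬e') = PairBijective-≗ (levelV-inner (<⇒≢ l<L) ¬e) (levelV-inner ¬e ¬e')
                                (alternating-step (isEven l))

  scheduleV : LevelSchedule L
  scheduleV = record
    { levelAt        = levelV
    ; levelAt<3      = levelV<3
    ; levelAt-wrap   = λ c → trans (levelV-wrapped refl c) (sym (levelV-start (suc c)))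
    ; levelAt-closed = trans (levelV-start 9) (sym (levelV-start 0))
    ; step-bijective = levelV-step-bijective
    }

  -- Deciding L ≟ suc l (not suc l ≟ L) keeps the with-abstractions in the lemmas
  -- below from also abstracting inside levelV (suc l).
  levelW : ℕ → ℕ → ℕ
  levelW zero = firstLevelW
  levelW (suc l) with L ≟ suc l
  ... | yes _ = firstLevelW ∘ suc
  ... | no _  = shift 1 (levelV (suc l))

  levelW-wrapped : ∀ {l} → l ≡ L → levelW l ≗ firstLevelW ∘ suc
  levelW-wrapped {zero} 0≡L = ⊥-elim (0≢L 0≡L)
  levelW-wrapped {suc l} e c with L ≟ suc l
  ... | yes _ = refl
  ... | no ¬e = ⊥-elim (¬e (sym e))

  levelW-inner : ∀ {l} → suc l ≢ L → levelW (suc l) ≗ shift 1 (levelV (suc l))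
  levelW-inner {l} ¬e c with L ≟ suc l
  ... | yes e = ⊥-elim (¬e (sym e))
  ... | no _  = refl

  levelW<3 : ∀ l c → levelW l c < 3
  levelW<3 zero c = firstLevelW<3 c
  levelW<3 (suc l) c with L ≟ suc l
  ... | yes _ = firstLevelW<3 (suc c)
  ... | no _  = m%n<n (levelV (suc l) c + 1) 3

  levelW-step-bijective : ∀ {l} → l < L → PairBijective (levelW l) (levelW (suc l))
  levelW-step-bijective {zero} _ =
    PairBijective-≗ (λ _ → refl)
      (λ c → trans (levelW-inner 1≢L c) (cong (λ z → (z + 1) % 3) (levelV-inner 1≢L 2≢L c)))
      firstLevelW-then-diagonal
  levelW-step-bijective {suc l} l<L = byCases (suc (suc l) ≟ L)
    where
    byCases : Dec (suc (suc l) ≡ L) → PairBijective (levelW (suc l)) (levelW (suc (suc l)))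
    byCases (yes e) = PairBijective-≗
      (λ c → trans (levelW-inner (<⇒≢ l<L) c) (cong (λ z → (z + 1) % 3) (levelV-last e c)))
      (levelW-wrapped e) byBlock-then-firstLevelW
    byCases (no ¬e) = PairBijective-≗ (levelW-inner (<⇒≢ l<L)) (levelW-inner ¬e)
      (PairBijective-shift 1 (levelV<3 (suc l)) (levelV<3 (suc (suc l))) (levelV-step-bijective l<L))

  scheduleW : LevelSchedule L
  scheduleW = record
    { levelAt        = levelW
    ; levelAt<3      = levelW<3
    ; levelAt-wrap   = levelW-wrapped refl
    ; levelAt-closed = refl
    ; step-bijective = levelW-step-bijective
    }

  levelV≢levelW : ∀ {l c} → l < L → c < 9 → l ≢ 0 ⊎ c ≢ 0 → levelV l c ≢ levelW l c
  levelV≢levelW {zero} _ _ (inj₁ 0≢0) = ⊥-elim (0≢0 refl)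
  levelV≢levelW {zero} {c} _ c<9 (inj₂ c≢0) e = firstLevelW≢byRound c<9 c≢0 (trans (sym e) (levelV-start c))
  levelV≢levelW {suc l} {c} l<L _ _ e = Modulo.[m+o]%n≢m%n 3 x (s≤s z≤n) (s≤s (s≤s z≤n)) (begin
    (x + 1) % 3       ≡⟨ levelW-inner (<⇒≢ l<L) c ⟨
    levelW (suc l) c  ≡⟨ e ⟨
    x                 ≡⟨ m<n⇒m%n≡m (levelV<3 (suc l) c) ⟨
    x % 3             ∎)
    where
    open ≡-Reasoning
    x : ℕ
    x = levelV (suc l) c

-- The complete multipartite graph

count : ℕ → (ℕ → Bool) → ℕ
count zero    q = 0
count (suc n) q = (if q 0 then 1 else 0) + count n (q ∘ suc)

length-filter-tabulate : ∀ {A : Set} {n} (f : Fin n → A) (p : A → Bool) (q : ℕ → Bool) →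
  (∀ i → p (f i) ≡ q (toℕ i)) → length (filter (T? ∘ p) (tabulate f)) ≡ count n q
length-filter-tabulate {n = zero}  f p q p≡q = refl
length-filter-tabulate {n = suc n} f p q p≡q with p (f Fin.zero) | p≡q Fin.zero
... | true  | e rewrite sym e = cong suc (length-filter-tabulate (f ∘ Fin.suc) p (q ∘ suc) (p≡q ∘ Fin.suc))
... | false | e rewrite sym e = length-filter-tabulate (f ∘ Fin.suc) p (q ∘ suc) (p≡q ∘ Fin.suc)

count-+ : ∀ a b q → count (a + b) q ≡ count a q + count b (q ∘ (a +_))
count-+ zero    b q = refl
count-+ (suc a) b q = trans (cong (first +_) (count-+ a b (q ∘ suc))) (sym (+-assoc first (count a (q ∘ suc)) _))
  where
  first : ℕ
  first = if q 0 then 1 else 0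

count-cong : ∀ n {q q'} → (∀ {y} → y < n → q y ≡ q' y) → count n q ≡ count n q'
count-cong zero    q≡q' = refl
count-cong (suc n) q≡q' =
  cong₂ _+_ (cong (λ b → if b then 1 else 0) (q≡q' (s≤s z≤n))) (count-cong n (q≡q' ∘ s≤s))

count-≢ : ∀ n {a} → a < n → count n (λ y → not (a ≡ᵇ y)) ≡ n ∸ 1
count-≢ (suc n) {zero}  _         = count-true n
  where
  count-true : ∀ n → count n (λ _ → true) ≡ n
  count-true zero    = refl
  count-true (suc n) = cong suc (count-true n)
count-≢ (suc n) {suc a} (s≤s a<n) = trans (cong suc (count-≢ n a<n)) (suc-pred n {{>-nonZero (≤-<-trans z≤n a<n)}})

count-%-≢ : ∀ j {t a} .{{_ : NonZero t}} → a < t → count (j * t) (λ y → not (a ≡ᵇ y % t)) ≡ j * (t ∸ 1)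
count-%-≢ zero    a<t = refl
count-%-≢ (suc j) {t} {a} a<t = begin
  count (t + j * t) q                            ≡⟨ count-+ t (j * t) q ⟩
  count t q + count (j * t) (q ∘ (t +_))         ≡⟨ cong₂ _+_ first-block other-blocks ⟩
  (t ∸ 1) + j * (t ∸ 1)                          ∎
  where
  open ≡-Reasoning
  q : ℕ → Bool
  q y = not (a ≡ᵇ y % t)
  first-block : count t q ≡ t ∸ 1
  first-block = trans (count-cong t (λ y<t → cong (λ z → not (a ≡ᵇ z)) (m<n⇒m%n≡m y<t))) (count-≢ t a<t)
  other-blocks : count (j * t) (q ∘ (t +_)) ≡ j * (t ∸ 1)
  other-blocks = trans (count-cong (j * t) (λ {y} _ → cong (λ z → not (a ≡ᵇ z))
                   (trans (cong (_% t) (+-comm t y)) ([m+n]%n≡m%n y t))))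
                 (count-%-≢ j a<t)

≡ᵇ-sym : ∀ a b → (a ≡ᵇ b) ≡ (b ≡ᵇ a)
≡ᵇ-sym zero    zero    = refl
≡ᵇ-sym zero    (suc b) = refl
≡ᵇ-sym (suc a) zero    = refl
≡ᵇ-sym (suc a) (suc b) = ≡ᵇ-sym a b

module CompleteMultipartite (t' : ℕ) where
  t n : ℕ
  t = suc t'
  n = 3 * t

  part level : Fin n → ℕ
  part x = toℕ x % t
  level x = toℕ x / t

  part<t : ∀ x → part x < t
  part<t x = m%n<n (toℕ x) t

  level<3 : ∀ x → level x < 3
  level<3 x = m<n*o⇒m/o<n (toℕ<n x)

  G : Graph n
  G = record
    { adj    = λ x y → not (part x ≡ᵇ part y)
    ; sym    = λ x y → cong not (≡ᵇ-sym (part x) (part y))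
    ; irrefl = λ x → cong not (dec-true (part x ≟ part x) refl)
    }

  part-≢⇒Adj : ∀ x y → part x ≢ part y → Adj G x y
  part-≢⇒Adj x y ne = subst (T ∘ not) (sym (dec-false (part x ≟ part y) ne)) tt

  Adj⇒part-≢ : ∀ x y → Adj G x y → part x ≢ part y
  Adj⇒part-≢ x y a e = subst (T ∘ not) (dec-true (part x ≟ part y) e) a

  part-level-injective : ∀ {x y} → part x ≡ part y → level x ≡ level y → x ≡ y
  part-level-injective {x} {y} ep el = toℕ-injective (begin
    toℕ x                   ≡⟨ m≡m%n+[m/n]*n (toℕ x) t ⟩
    part x + level x * t    ≡⟨ cong₂ (λ p a → p + a * t) ep el ⟩
    part y + level y * t    ≡⟨ m≡m%n+[m/n]*n (toℕ y) t ⟨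
    toℕ y                   ∎)
    where open ≡-Reasoning

  encoding<n : ∀ {a p} → a < 3 → p < t → p + a * t < n
  encoding<n {a} {p} a<3 p<t = begin-strict
    p + a * t  <⟨ +-monoˡ-< (a * t) p<t ⟩
    suc a * t  ≤⟨ *-monoˡ-≤ t a<3 ⟩
    3 * t      ∎
    where open ≤-Reasoning

  vertex : ∀ {a p} → a < 3 → p < t → Fin n
  vertex a<3 p<t = fromℕ< (encoding<n a<3 p<t)

  part-vertex : ∀ {a p} (a<3 : a < 3) (p<t : p < t) → part (vertex a<3 p<t) ≡ p
  part-vertex {a} {p} a<3 p<t =
    trans (cong (_% t) (toℕ-fromℕ< (encoding<n a<3 p<t))) (Modulo.[m+kn]%n≡m t p a p<t)

  level-vertex : ∀ {a p} (a<3 : a < 3) (p<t : p < t) → level (vertex a<3 p<t) ≡ a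
  level-vertex {a} {p} a<3 p<t =
    trans (cong (_/ t) (toℕ-fromℕ< (encoding<n a<3 p<t))) (Modulo.[m+kn]/n≡k t p a p<t)

  degree-G : ∀ x → degree G x ≡ n ∸ 3
  degree-G x = begin
    degree G x                                  ≡⟨ length-filter-tabulate (λ y → y) (adj G x) q (λ _ → refl) ⟩
    count (3 * t) q                             ≡⟨ count-%-≢ 3 (part<t x) ⟩
    3 * (t ∸ 1)                                 ≡⟨ *-distribˡ-∸ 3 t 1 ⟩
    n ∸ 3                                       ∎
    where
    open ≡-Reasoning
    q : ℕ → Bool
    q y = not (part x ≡ᵇ y % t)

  connected : 1 < t → Connected G
  connected 1<t x y with part x ≟ part y
  ... | no ne = 1 , w , isWalk , refl , refl
    where
    w : Fin 2 → Fin n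
    w Fin.zero    = x
    w (Fin.suc _) = y
    isWalk : IsWalk G 1 w
    isWalk Fin.zero = part-≢⇒Adj x y ne
  ... | yes eq = 2 , w , isWalk , refl , refl
    where
    z : Fin n
    z = vertex {0} (s≤s z≤n) (m%n<n (part x + 1) t)
    part-z≢ : part z ≢ part x
    part-z≢ e = Modulo.[m+o]%n≢m%n t (part x) (s≤s z≤n) 1<t
      (trans (sym (part-vertex (s≤s z≤n) (m%n<n (part x + 1) t))) (trans e (sym (m%n%n≡m%n (toℕ x) t))))
    w : Fin 3 → Fin n
    w Fin.zero              = x
    w (Fin.suc Fin.zero)    = z
    w (Fin.suc (Fin.suc _)) = y
    isWalk : IsWalk G 2 w
    isWalk Fin.zero           = part-≢⇒Adj x z (part-z≢ ∘ sym)
    isWalk (Fin.suc Fin.zero) = part-≢⇒Adj z y λ e → part-z≢ (trans e (sym eq))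

-- Lifting circuits

module Lift {t' L : ℕ} .{{_ : NonZero L}} (E : CompleteEulerCircuit (suc t') L) (S : LevelSchedule L) where
  open CompleteMultipartite t'
  open CompleteEulerCircuit E
  open LevelSchedule S

  m : ℕ
  m = 9 * L

  vertexAt : ℕ → ℕ → Fin n
  vertexAt l c = vertex (levelAt<3 l c) (pos<t l)

  part-vertexAt : ∀ l c → part (vertexAt l c) ≡ pos l
  part-vertexAt l c = part-vertex (levelAt<3 l c) (pos<t l)

  level-vertexAt : ∀ l c → level (vertexAt l c) ≡ levelAt l c
  level-vertexAt l c = level-vertex (levelAt<3 l c) (pos<t l)

  vertexAt-≡ : ∀ {l c l' c'} → vertexAt l c ≡ vertexAt l' c' → pos l ≡ pos l' × levelAt l c ≡ levelAt l' c'
  vertexAt-≡ {l} {c} {l'} {c'} e =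
    trans (sym (part-vertexAt l c)) (trans (cong part e) (part-vertexAt l' c')) ,
    trans (sym (level-vertexAt l c)) (trans (cong level e) (level-vertexAt l' c'))

  vertexAt-unique : ∀ {l c} x → pos l ≡ part x → levelAt l c ≡ level x → vertexAt l c ≡ x
  vertexAt-unique {l} {c} x ep el =
    part-level-injective (trans (part-vertexAt l c) ep) (trans (level-vertexAt l c) el)

  vertexAt-wrap : ∀ c → vertexAt L c ≡ vertexAt 0 (suc c)
  vertexAt-wrap c = vertexAt-unique (vertexAt 0 (suc c))
    (trans pos-closed (sym (part-vertexAt 0 (suc c)))) (trans (levelAt-wrap c) (sym (level-vertexAt 0 (suc c))))

  vertexAt-next : ∀ N → vertexAt (suc N % L) (suc N / L) ≡ vertexAt (suc (N % L)) (N / L)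
  vertexAt-next N with Modulo.sucDivMod L N
  ... | Modulo.sameBlock r q      = cong₂ vertexAt r q
  ... | Modulo.nextBlock full r q = begin
    vertexAt (suc N % L) (suc N / L) ≡⟨ cong₂ vertexAt r q ⟩
    vertexAt 0 (suc (N / L))         ≡⟨ vertexAt-wrap (N / L) ⟨
    vertexAt L (N / L)               ≡⟨ cong (λ l → vertexAt l (N / L)) full ⟨
    vertexAt (suc (N % L)) (N / L)   ∎
    where open ≡-Reasoning

  vertexAt-adjacent : ∀ {l} c → l < L → Adj G (vertexAt l c) (vertexAt (suc l) c)
  vertexAt-adjacent {l} c l<L = part-≢⇒Adj (vertexAt l c) (vertexAt (suc l) c) λ e →
    step-≢ l<L (trans (sym (part-vertexAt l c)) (trans e (part-vertexAt (suc l) c)))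

  step-vertexAt-injective : ∀ {l c l' c'} → l < L → l' < L → c < 9 → c' < 9 →
    vertexAt l c ≡ vertexAt l' c' → vertexAt (suc l) c ≡ vertexAt (suc l') c' → l ≡ l' × c ≡ c'
  step-vertexAt-injective {l} {c} {l'} {c'} l<L l'<L c<9 c'<9 e₁ e₂ = l≡l' , c≡c'
    where
    e₁' = vertexAt-≡ e₁
    e₂' = vertexAt-≡ e₂
    l≡l' : l ≡ l'
    l≡l' = step-injective l<L l'<L (proj₁ e₁') (proj₁ e₂')
    c≡c' : c ≡ c'
    c≡c' = proj₁ (step-bijective l<L) c<9 c'<9
      (trans (proj₂ e₁') (cong (λ z → levelAt z c') (sym l≡l')) ,
       trans (proj₂ e₂') (cong (λ z → levelAt (suc z) c') (sym l≡l')))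

  step-vertexAt-not-reversed : ∀ {l c l' c'} → l < L → l' < L →
    vertexAt l c ≡ vertexAt (suc l') c' → vertexAt (suc l) c ≡ vertexAt l' c' → ⊥
  step-vertexAt-not-reversed l<L l'<L e₁ e₂ =
    no-reversed-step l<L l'<L (proj₁ (vertexAt-≡ e₁)) (proj₁ (vertexAt-≡ e₂))

  step-vertexAt-from : ∀ {l} x y → l < L → pos l ≡ part x → pos (suc l) ≡ part y →
    ∃ λ c → c < 9 × vertexAt l c ≡ x × vertexAt (suc l) c ≡ y
  step-vertexAt-from x y l<L ex ey =
    let (c , c<9 , fx , fy) = proj₂ (step-bijective l<L) (level<3 x) (level<3 y)
    in c , c<9 , vertexAt-unique x ex fx , vertexAt-unique y ey fy

  -- the steps of the lifted circuit are indexed by i = l + c * L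

  walk : Fin (suc m) → Fin n
  walk i = vertexAt (toℕ i % L) (toℕ i / L)

  walk-before : ∀ (i : Fin m) → walk (inject₁ i) ≡ vertexAt (toℕ i % L) (toℕ i / L)
  walk-before i = cong (λ N → vertexAt (N % L) (N / L)) (toℕ-inject₁ i)

  walk-after : ∀ (i : Fin m) → walk (Fin.suc i) ≡ vertexAt (suc (toℕ i % L)) (toℕ i / L)
  walk-after i = vertexAt-next (toℕ i)

  step<L : ∀ (i : Fin m) → toℕ i % L < L
  step<L i = m%n<n (toℕ i) L

  round<9 : ∀ (i : Fin m) → toℕ i / L < 9
  round<9 i = m<n*o⇒m/o<n (toℕ<n i)

  index : ∀ {l c} → l < L → c < 9 → Σ (Fin m) λ i → toℕ i % L ≡ l × toℕ i / L ≡ c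
  index {l} {c} l<L c<9 = fromℕ< l+cL<m ,
    trans (cong (_% L) (toℕ-fromℕ< l+cL<m)) (Modulo.[m+kn]%n≡m L l c l<L) ,
    trans (cong (_/ L) (toℕ-fromℕ< l+cL<m)) (Modulo.[m+kn]/n≡k L l c l<L)
    where
    l+cL<m : l + c * L < m
    l+cL<m = begin-strict
      l + c * L  <⟨ +-monoˡ-< (c * L) l<L ⟩
      suc c * L  ≤⟨ *-monoˡ-≤ L c<9 ⟩
      9 * L      ∎
      where open ≤-Reasoning

  index-injective : ∀ {i j : Fin m} → toℕ i % L ≡ toℕ j % L → toℕ i / L ≡ toℕ j / L → i ≡ j
  index-injective {i} {j} el ec = toℕ-injective (begin
    toℕ i                       ≡⟨ m≡m%n+[m/n]*n (toℕ i) L ⟩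
    toℕ i % L + toℕ i / L * L   ≡⟨ cong₂ (λ l c → l + c * L) el ec ⟩
    toℕ j % L + toℕ j / L * L   ≡⟨ m≡m%n+[m/n]*n (toℕ j) L ⟨
    toℕ j                       ∎)
    where open ≡-Reasoning

  isWalk : IsWalk G m walk
  isWalk i = subst₂ (Adj G) (sym (walk-before i)) (sym (walk-after i)) (vertexAt-adjacent (toℕ i / L) (step<L i))

  same-step : ∀ (i j : Fin m) →
              walk (inject₁ i) ≡ walk (inject₁ j) → walk (Fin.suc i) ≡ walk (Fin.suc j) → i ≡ j
  same-step i j e₁ e₂ = index-injective (proj₁ same) (proj₂ same)
    where
    same = step-vertexAt-injective (step<L i) (step<L j) (round<9 i) (round<9 j)
      (trans (sym (walk-before i)) (trans e₁ (walk-before j)))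
      (trans (sym (walk-after i)) (trans e₂ (walk-after j)))

  reversed-step : ∀ (i j : Fin m) →
                  walk (inject₁ i) ≡ walk (Fin.suc j) → walk (Fin.suc i) ≡ walk (inject₁ j) → ⊥
  reversed-step i j e₁ e₂ = step-vertexAt-not-reversed (step<L i) (step<L j)
    (trans (sym (walk-before i)) (trans e₁ (walk-after j)))
    (trans (sym (walk-after i)) (trans e₂ (walk-before j)))

  traversed-once : ∀ {x y} (i j : Fin m) → Traverses walk i x y → Traverses walk j x y → j ≡ i
  traversed-once i j (inj₁ (a , b)) (inj₁ (a' , b')) = same-step j i (trans a' (sym a)) (trans b' (sym b))
  traversed-once i j (inj₂ (a , b)) (inj₂ (a' , b')) = same-step j i (trans a' (sym a)) (trans b' (sym b))
  traversed-once i j (inj₁ (a , b)) (inj₂ (a' , b')) = ⊥-elim (reversed-step j i (trans a' (sym b)) (trans b' (sym a)))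
  traversed-once i j (inj₂ (a , b)) (inj₁ (a' , b')) = ⊥-elim (reversed-step j i (trans a' (sym b)) (trans b' (sym a)))

  step-from : ∀ {l} x y → l < L → pos l ≡ part x → pos (suc l) ≡ part y →
    Σ (Fin m) λ i → walk (inject₁ i) ≡ x × walk (Fin.suc i) ≡ y
  step-from {l} x y l<L ex ey =
    let (c , c<9 , fx , fy) = step-vertexAt-from x y l<L ex ey
        (i , il , ic) = index l<L c<9
    in i , trans (walk-before i) (trans (cong₂ vertexAt il ic) fx)
         , trans (walk-after i) (trans (cong₂ (λ l → vertexAt (suc l)) il ic) fy)

  traversed : ∀ x y → Adj G x y → Σ (Fin m) λ i → Traverses walk i x y
  traversed x y a with edge-traversed (part<t x) (part<t y) (Adj⇒part-≢ x y a)
  ... | l , l<L , inj₁ (ex , ey) = let (i , wx , wy) = step-from x y l<L ex ey in i , inj₁ (wx , wy)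
  ... | l , l<L , inj₂ (ey , ex) = let (i , wy , wx) = step-from y x l<L ey ex in i , inj₂ (wy , wx)

  walk-start : walk Fin.zero ≡ vertexAt 0 0
  walk-start = cong₂ vertexAt (m<n⇒m%n≡m (>-nonZero⁻¹ L)) (0/n≡0 L)

  walk-closed : walk (fromℕ m) ≡ walk Fin.zero
  walk-closed = begin
    vertexAt (toℕ (fromℕ m) % L) (toℕ (fromℕ m) / L)  ≡⟨ cong (λ N → vertexAt (N % L) (N / L)) (toℕ-fromℕ m) ⟩
    vertexAt (m % L) (m / L)                          ≡⟨ cong₂ vertexAt (m*n%n≡0 9 L) (m*n/n≡m 9 L) ⟩
    vertexAt 0 9                                      ≡⟨ vertexAt-unique (vertexAt 0 0) (sym (part-vertexAt 0 0))
                                                           (trans levelAt-closed (sym (level-vertexAt 0 0))) ⟩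
    vertexAt 0 0                                      ≡⟨ walk-start ⟨
    walk Fin.zero                                     ∎
    where open ≡-Reasoning

  eulerianCircuit : ∀ u → pos 0 ≡ part u → levelAt 0 0 ≡ level u → IsEulerianCircuit G u m walk
  eulerianCircuit u ep el = isWalk , start , trans walk-closed start ,
    λ x y a → let (i , tr) = traversed x y a in i , tr , λ j tj → traversed-once i j tr tj
    where
    start : walk Fin.zero ≡ u
    start = trans walk-start (vertexAt-unique u ep el)

module LiftedPair {t' L : ℕ} .{{_ : NonZero L}} (E : CompleteEulerCircuit (suc t') L) (S S' : LevelSchedule L)
  (levels-differ : ∀ {l c} → l < L → c < 9 → l ≢ 0 ⊎ c ≢ 0 →
                   LevelSchedule.levelAt S l c ≢ LevelSchedule.levelAt S' l c) where
  open CompleteMultipartite t'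
  module V = Lift E S
  module W = Lift E S'

  apart : ∀ (i : Fin (suc V.m)) → toℕ i ≢ 0 → toℕ i < V.m →
          V.walk i ≢ W.walk i × ¬ Adj G (V.walk i) (W.walk i)
  apart i i≢0 i<m = (λ e → levels-differ l<L c<9 not-start (level-≡ e)) ,
                    (λ a → Adj⇒part-≢ (V.walk i) (W.walk i) a same-part)
    where
    l c : ℕ
    l = toℕ i % L
    c = toℕ i / L
    l<L : l < L
    l<L = m%n<n (toℕ i) L
    c<9 : c < 9
    c<9 = m<n*o⇒m/o<n i<m
    not-start : l ≢ 0 ⊎ c ≢ 0
    not-start = m≢0⇒m%n≢0⊎m/n≢0 L i≢0
    same-part : part (V.walk i) ≡ part (W.walk i)
    same-part = trans (V.part-vertexAt l c) (sym (W.part-vertexAt l c))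
    level-≡ : V.walk i ≡ W.walk i → LevelSchedule.levelAt S l c ≡ LevelSchedule.levelAt S' l c
    level-≡ e = trans (sym (V.level-vertexAt l c)) (trans (cong level e) (W.level-vertexAt l c))

-- Graphs of order 3(2k + 1)

module OddOrder (k' : ℕ) where
  k t' : ℕ
  k = suc k'
  t' = k + k
  open CompleteMultipartite t'

  L : ℕ
  L = t * k

  3≤L : 3 ≤ L
  3≤L = *-mono-≤ {3} {t} {1} {k} (s≤s (+-mono-≤ (s≤s z≤n) (s≤s z≤n))) (s≤s z≤n)

  open Schedules L 3≤L

  module AtVertex (u : Fin n) where
    circuitK : CompleteEulerCircuit t L
    circuitK = OddCompleteEulerCircuit.circuit k' (part u)

    open LiftedPair circuitK (shiftSchedule (level u) scheduleV) (shiftSchedule (level u) scheduleW)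
      (λ {l} {c} l<L c<9 not-start e → levelV≢levelW l<L c<9 not-start
         (shift-injective (level u) (levelV<3 l c) (levelW<3 l c) e)) public

    pos₀ : CompleteEulerCircuit.pos circuitK 0 ≡ part u
    pos₀ = m%n%n≡m%n (toℕ u) t

    level₀ : ∀ {a} → a ≡ 0 → (a + level u) % 3 ≡ level u
    level₀ refl = m<n⇒m%n≡m (level<3 u)

    circuitV : IsEulerianCircuit G u V.m V.walk
    circuitV = V.eulerianCircuit u pos₀ (level₀ (levelV-start 0))

    circuitW : IsEulerianCircuit G u V.m W.walk
    circuitW = W.eulerianCircuit u pos₀ (level₀ refl)

    avoiding : Avoiding G V.m V.walk W.walk
    avoiding j = apart (Fin.suc (inject₁ j)) (λ ()) (s≤s (subst (_< _) (sym (toℕ-inject₁ j)) (toℕ<n j)))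

  doublyEulerian : DoublyEulerian G
  doublyEulerian = (connected (s≤s (s≤s z≤n)) , Fin.zero , _ , V.walk Fin.zero , circuitV Fin.zero) ,
                   λ u → _ , V.walk u , W.walk u , circuitV u , circuitW u , avoiding u
    where open AtVertex

n%6≡3⇒n≡3[2k+1] : ∀ {n} → n % 6 ≡ 3 → 9 ≤ n → ∃ λ k' → n ≡ 3 * suc (suc k' + suc k')
n%6≡3⇒n≡3[2k+1] {n} n%6≡3 9≤n with n / 6 | m≡m%n+[m/n]*n n 6
... | zero   | n≡ = ⊥-elim (<⇒≱ (s≤s (s≤s (s≤s (s≤s z≤n))))
                                  (subst (9 ≤_) (trans n≡ (cong (_+ 0) n%6≡3)) 9≤n))
... | suc k' | n≡ = k' , trans n≡ (trans (cong (_+ suc k' * 6) n%6≡3) (regroup k'))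
  where
  regroup : ∀ k' → 3 + suc k' * 6 ≡ 3 * suc (suc k' + suc k')
  regroup = solve-∀

theorem1 : ∀ (n : ℕ) → n % 6 ≡ 3 → 9 ≤ n →
    Σ (Graph n) λ G → DoublyEulerian G × (∀ (x : Fin n) → degree G x ≡ n ∸ 3)
theorem1 n n%6≡3 9≤n with n%6≡3⇒n≡3[2k+1] n%6≡3 9≤n
... | k' , refl = G , doublyEulerian , degree-G
  where
  open OddOrder k'
  open CompleteMultipartite t'
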